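{- Let $\mathbf{F}_{\mathcal{L}}$ be a polynomial transformation over the language semiring $\mathcal{L}$ with variables $\mathcal{X}$, and let $\mathbf{F}_{\mathcal{P}}$ be the polynomial transformation over the Parikh semiring $\mathcal{P}$ with $(\mathbf{F}_{\mathcal{P}})_X=\Pi\circ(\mathbf{F}_{\mathcal{L}})_X\circ\Pi^{ -1}$ for each $X\in\mathcal{X}$. Let $(\boldsymbol{\nu}_i)_{i\in\mathbb{N}}$ and $(\boldsymbol{\kappa}_i)_{i\in\mathbb{N}}$ be Newton's iteration sequences associated with $\mathbf{F}_{\mathcal{L}}$ and $\mathbf{F}_{\mathcal{P}}$ respectively. Then $\Pi(\boldsymbol{\nu}_i)=\boldsymbol{\kappa}_i$ for every $i\in\mathbb{N}$.
   Context: $\Sigma=\{a_1,\dots,a_p\}$ linearly ordered; $\Pi$ is the Parikh map ($\Pi(a_i)=\mathbf{e}_i$, $\Pi(\varepsilon)=\mathbf{0}$, $\Pi(uv)=\Pi(u)+\Pi(v)$), extended setwise to languages and componentwise to valuations; $\Pi^{ -1}(M)=\{y\mid\Pi(y)\in M\}$. $\mathcal{L}=\langle2^{\Sigma^*},\cup,\cdot,\emptyset,\{\varepsilon\}\rangle$; $\mathcal{P}=\langle2^{\mathbb{N}^p},\cup,\dotplus,\emptyset,\{\mathbf{0}\}\rangle$ with $Z\dotplus Z'=\{z+z'\}$. $\mathcal{X}$ is a finite variable set; a valuation is a map $\mathcal{X}\to S$; $\ddot0$ maps every variable to $\bar0$. A polynomial is a finite $\oplus$-combination of monomials $a_1\odot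 X_1\cdots a_k\odot X_k\odot a_{k+1}$; a polynomial transformation $\mathbf{F}$ is a family $(\mathbf{F}_X)_{X\in\mathcal{X}}$ of polynomials, acting on valuations by $\mathbf{F}(\mathbf{v})(X)=\mathbf{F}_X(\mathbf{v})$. ($\mathbf{F}_{\mathcal{P}}$ is obtained from $\mathbf{F}_{\mathcal{L}}$ by replacing each coefficient $a$ by $\Pi(a)$ and $\cdot$ by $\dotplus$.) Differential: for a polynomial $f$, $D_Xf|_{\mathbf{v}}$ is defined inductively by $D_Xf|_{\mathbf{v}}(\mathbf{w})=\bar0$ if $f\in S$ or $f\in\mathcal{X}\setminus\{X\}$; $=\mathbf{w}(X)$ if $f=X$; $=D_Xg|_{\mathbf{v}}(\mathbf{w})\odot h(\mathbf{v})\oplus g(\mathbf{v})\odot D_Xh|_{\mathbf{v}}(\mathbf{w})$ if $f=g\odot h$; $=D_Xg|_{\mathbf{v}}(\mathbf{w})\oplus D_Xh|_{\mathbf{v}}(\mathbf{w})$ if $f=g\oplus h$. Then $Df|_{\mathbf{v}}=\bigoplus_{X\in\mathcal{X}}D_Xf|_{\mathbf{v}}$ and $D\mathbf{F}|_{\mathbf{v}}(\mathbf{w})(X)=D\mathbf{F}_X|_{\mathbf{v}}(\mathbf{w})$. For a map $H$ on valuations, $H^*(\mathbf{w})=\bigoplus_{j\ge0}H^j(\mathbf{w})$ (pointwise). Newton's iteration sequence of $\mathbf{F}$: $\boldsymbol{\mu}_0=\mathbf{F}(\ddot0)$ and $\boldsymbol{\mu}_{i+1}=(D\mathbf{F}|_{\boldsymbol{\mu}_i})^*(\mathbf{F}(\boldsymbol{\mu}_i))$.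 -}

module Defs where

open import Data.Nat using (ℕ; zero; suc; _+_)
open import Data.Fin using (Fin; zero; suc; _≟_)
open import Data.List using (List; []; _∷_; _++_)
open import Data.Vec using (Vec; replicate; zipWith; tabulate)
open import Data.Product using (Σ; ∃; ∃₂; _×_; _,_)
open import Data.Sum using (_⊎_)
open import Data.Empty using (⊥)
open import Relation.Nullary using (yes; no)
open import Relation.Binary.PropositionalEquality using (_≡_)

-- A monomial  a₁ ⊙ X₁ ⊙ a₂ ⊙ X₂ ⋯ aₖ ⊙ Xₖ ⊙ aₖ₊₁  is a list of
-- (coefficient, variable) pairs followed by a final coefficient.

data Mono (C : Set₁) (n : ℕ) : Set₁ where
  coef   : C → Mono C n
  _·X_·_ : C → Fin n → Mono C n → Mono C n

Poly : Set₁ → ℕ → Set₁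
Poly C n = List (Mono C n)

PolyT : Set₁ → ℕ → Set₁
PolyT C n = Fin n → Poly C n

mapMono : ∀ {C D n} → (C → D) → Mono C n → Mono D n
mapMono f (coef a)       = coef (f a)
mapMono f (a ·X x · m)   = f a ·X x · mapMono f m

mapPoly : ∀ {C D n} → (C → D) → Poly C n → Poly D n
mapPoly f []       = []
mapPoly f (m ∷ ms) = mapMono f m ∷ mapPoly f ms

mapPolyT : ∀ {C D n} → (C → D) → PolyT C n → PolyT D n
mapPolyT f F X = mapPoly f (F X)

-- The power-set semiring ⟨2^M, ∪, ·, ∅, {e}⟩ of a monoid (M, ∙, e).
-- Sets are predicates; L = power set of (Σ*, ++, ε),
-- P = power set of (ℕ^p, +, 0).

module PowerSemiring {M : Set} (_∙_ : M → M → M) (e : M) where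

  𝓢 : Set₁
  𝓢 = M → Set

  _⊕_ : 𝓢 → 𝓢 → 𝓢
  (A ⊕ B) m = A m ⊎ B m

  _⊙_ : 𝓢 → 𝓢 → 𝓢
  (A ⊙ B) m = ∃₂ λ a b → A a × B b × m ≡ (a ∙ b)

  infixl 6 _⊕_
  infixl 7 _⊙_

  𝟘 : 𝓢
  𝟘 _ = ⊥

  𝟙 : 𝓢
  𝟙 m = m ≡ e

  Val : ℕ → Set₁
  Val n = Fin n → 𝓢

  0̈ : ∀ {n} → Val n
  0̈ _ = 𝟘

  ⨁ : ∀ {n} → (Fin n → 𝓢) → 𝓢
  ⨁ {zero}  f = 𝟘
  ⨁ {suc n} f = f zero ⊕ ⨁ (λ i → f (suc i))

  evalM : ∀ {n} → Mono 𝓢 n → Val n → 𝓢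
  evalM (coef a)     v = a
  evalM (a ·X x · m) v = (a ⊙ v x) ⊙ evalM m v

  evalP : ∀ {n} → Poly 𝓢 n → Val n → 𝓢
  evalP []       v = 𝟘
  evalP (m ∷ ms) v = evalM m v ⊕ evalP ms v

  applyT : ∀ {n} → PolyT 𝓢 n → Val n → Val n
  applyT F v X = evalP (F X) v

  DXvar : ∀ {n} → Fin n → Fin n → Val n → 𝓢
  DXvar Y x w with Y ≟ x
  ... | yes _ = w x
  ... | no  _ = 𝟘

  -- D_Y f|_v (w), following the inductive definition:
  -- constants ↦ 0, variables ↦ w(Y) or 0, product rule, sum rule.
  DXM : ∀ {n} → Fin n → Mono 𝓢 n → Val n → Val n → 𝓢
  DXM Y (coef a)     v w = 𝟘
  DXM Y (a ·X x · m) v w =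
    ((𝟘 ⊙ v x ⊕ a ⊙ DXvar Y x w) ⊙ evalM m v) ⊕ ((a ⊙ v x) ⊙ DXM Y m v w)

  DXP : ∀ {n} → Fin n → Poly 𝓢 n → Val n → Val n → 𝓢
  DXP Y []       v w = 𝟘
  DXP Y (m ∷ ms) v w = DXM Y m v w ⊕ DXP Y ms v w

  DP : ∀ {n} → Poly 𝓢 n → Val n → Val n → 𝓢
  DP f v w = ⨁ (λ Y → DXP Y f v w)

  DF : ∀ {n} → PolyT 𝓢 n → Val n → Val n → Val n
  DF F v w X = DP (F X) v w

  iter : ∀ {n} → (Val n → Val n) → ℕ → Val n → Val n
  iter H zero    w = w
  iter H (suc j) w = H (iter H j w)

  star : ∀ {n} → (Val n → Val n) → Val n → Val n
  star H w X m = ∃ λ j → iter H j w X m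

  newton : ∀ {n} → PolyT 𝓢 n → ℕ → Val n
  newton F zero    = applyT F 0̈
  newton F (suc i) = star (DF F (newton F i)) (applyT F (newton F i))

Word : ℕ → Set
Word p = List (Fin p)

Vecℕ : ℕ → Set
Vecℕ p = Vec ℕ p

unit : ∀ {p} → Fin p → Vecℕ p
unit i = tabulate λ j → δ j
  where
  δ : _ → ℕ
  δ j with j ≟ i
  ... | yes _ = 1
  ... | no  _ = 0

_+ᵥ_ : ∀ {p} → Vecℕ p → Vecℕ p → Vecℕ p
_+ᵥ_ = zipWith _+_

𝟎 : ∀ {p} → Vecℕ p
𝟎 {p} = replicate p 0

Π : ∀ {p} → Word p → Vecℕ p
Π []      = 𝟎
Π (a ∷ w) = unit a +ᵥ Π w

module 𝓛 (p : ℕ) = PowerSemiring {Word p} _++_ []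
module 𝓟 (p : ℕ) = PowerSemiring {Vecℕ p} _+ᵥ_ 𝟎

Lang : ℕ → Set₁
Lang p = Word p → Set

PSet : ℕ → Set₁
PSet p = Vecℕ p → Set

ΠL : ∀ {p} → Lang p → PSet p
ΠL L z = ∃ λ w → L w × Π w ≡ z

ΠPolyT : ∀ {p n} → PolyT (Lang p) n → PolyT (PSet p) n
ΠPolyT = mapPolyT ΠL

-- Π is a monoid homomorphism Σ* → ℕᵖ, so taking images along Π commutes
-- with ∅, ∪ and concatenation/sum, and with countable unions.  Newton's
-- sequence is assembled from these operations alone (evaluation of
-- polynomials, differentials, iteration and Kleene star), so by induction
-- on i the image of νᵢ is κᵢ.
module Submission where

open import Defs
open import Data.Nat using (ℕ; zero; suc)
open import Data.Nat.Properties using (+-assoc; +-identityˡ)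
open import Data.Vec.Properties using (zipWith-assoc; zipWith-identityˡ)
open import Data.Fin using (Fin; zero; suc; _≟_)
open import Data.List using ([]; _∷_; _++_)
open import Data.Product using (∃; _×_; _,_)
open import Data.Sum using (inj₁; inj₂)
open import Function.Bundles using (_⇔_; mk⇔; Equivalence)
open import Relation.Nullary using (yes; no)
open import Relation.Binary.PropositionalEquality
  using (_≡_; refl; sym; trans; cong; cong₂; module ≡-Reasoning)

open Equivalence

Π-++ : ∀ {p} (u v : Word p) → Π (u ++ v) ≡ Π u +ᵥ Π v
Π-++ []      v = sym (zipWith-identityˡ +-identityˡ (Π v))
Π-++ (a ∷ u) v = begin
  unit a +ᵥ Π (u ++ v)     ≡⟨ cong (unit a +ᵥ_) (Π-++ u v) ⟩
  unit a +ᵥ (Π u +ᵥ Π v)   ≡⟨ zipWith-assoc +-assoc (unit a) (Π u) (Π v) ⟨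
  (unit a +ᵥ Π u) +ᵥ Π v   ∎
  where open ≡-Reasoning

module Image {M N : Set} (_∙_ : M → M → M) (e : M) (_∘_ : N → N → N) (e′ : N)
             (h : M → N) (h-∙ : ∀ a b → h (a ∙ b) ≡ h a ∘ h b) where

  module 𝓜 = PowerSemiring _∙_ e
  module 𝓝 = PowerSemiring _∘_ e′

  image : 𝓜.𝓢 → 𝓝.𝓢
  image A z = ∃ λ w → A w × h w ≡ z

  infix 4 _↦_ _↦ᵛ_

  _↦_ : 𝓜.𝓢 → 𝓝.𝓢 → Set
  A ↦ B = ∀ z → image A z ⇔ B z

  _↦ᵛ_ : ∀ {n} → 𝓜.Val n → 𝓝.Val n → Set
  v ↦ᵛ v′ = ∀ x → v x ↦ v′ x

  image-↦ : ∀ A → A ↦ image A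
  image-↦ A z = mk⇔ (λ x → x) (λ x → x)

  image-𝟘 : 𝓜.𝟘 ↦ 𝓝.𝟘
  image-𝟘 z = mk⇔ (λ { (_ , () , _) }) (λ ())

  image-⊕ : ∀ {A A′ B B′} → A ↦ A′ → B ↦ B′ → A 𝓜.⊕ B ↦ A′ 𝓝.⊕ B′
  image-⊕ A↦ B↦ z = mk⇔
    (λ { (w , inj₁ a , hw) → inj₁ (to (A↦ z) (w , a , hw))
       ; (w , inj₂ b , hw) → inj₂ (to (B↦ z) (w , b , hw)) })
    (λ { (inj₁ a′) → let (w , a , hw) = from (A↦ z) a′ in w , inj₁ a , hw
       ; (inj₂ b′) → let (w , b , hw) = from (B↦ z) b′ in w , inj₂ b , hw })

  image-⊙ : ∀ {A A′ B B′} → A ↦ A′ → B ↦ B′ → A 𝓜.⊙ B ↦ A′ 𝓝.⊙ B′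
  image-⊙ A↦ B↦ z = mk⇔
    (λ { (_ , (u , v , a , b , refl) , huv) →
           h u , h v , to (A↦ _) (u , a , refl) , to (B↦ _) (v , b , refl) ,
           trans (sym huv) (h-∙ u v) })
    (λ { (x , y , a′ , b′ , refl) →
           let (u , a , hu) = from (A↦ x) a′
               (v , b , hv) = from (B↦ y) b′
           in u ∙ v , (u , v , a , b , refl) , trans (h-∙ u v) (cong₂ _∘_ hu hv) })

  image-⨁ : ∀ {n} {f : Fin n → 𝓜.𝓢} {g : Fin n → 𝓝.𝓢} →
    (∀ i → f i ↦ g i) → 𝓜.⨁ f ↦ 𝓝.⨁ g
  image-⨁ {zero}  f↦ = image-𝟘
  image-⨁ {suc n} f↦ = image-⊕ (f↦ zero) (image-⨁ (λ i → f↦ (suc i)))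

  image-evalM : ∀ {n} (m : Mono 𝓜.𝓢 n) {v v′} → v ↦ᵛ v′ →
    𝓜.evalM m v ↦ 𝓝.evalM (mapMono image m) v′
  image-evalM (coef a)     v↦ = image-↦ a
  image-evalM (a ·X x · m) v↦ =
    image-⊙ (image-⊙ (image-↦ a) (v↦ x)) (image-evalM m v↦)

  image-evalP : ∀ {n} (f : Poly 𝓜.𝓢 n) {v v′} → v ↦ᵛ v′ →
    𝓜.evalP f v ↦ 𝓝.evalP (mapPoly image f) v′
  image-evalP []      v↦ = image-𝟘
  image-evalP (m ∷ f) v↦ = image-⊕ (image-evalM m v↦) (image-evalP f v↦)

  image-applyT : ∀ {n} (F : PolyT 𝓜.𝓢 n) {v v′} → v ↦ᵛ v′ →
    𝓜.applyT F v ↦ᵛ 𝓝.applyT (mapPolyT image F) v′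
  image-applyT F v↦ X = image-evalP (F X) v↦

  image-DXvar : ∀ {n} (Y x : Fin n) {w w′} → w ↦ᵛ w′ →
    𝓜.DXvar Y x w ↦ 𝓝.DXvar Y x w′
  image-DXvar Y x w↦ with Y ≟ x
  ... | yes _ = w↦ x
  ... | no  _ = image-𝟘

  image-DXM : ∀ {n} (Y : Fin n) (m : Mono 𝓜.𝓢 n) {v v′ w w′} → v ↦ᵛ v′ → w ↦ᵛ w′ →
    𝓜.DXM Y m v w ↦ 𝓝.DXM Y (mapMono image m) v′ w′
  image-DXM Y (coef a)     v↦ w↦ = image-𝟘
  image-DXM Y (a ·X x · m) v↦ w↦ =
    image-⊕ (image-⊙ (image-⊕ (image-⊙ image-𝟘 (v↦ x))
                              (image-⊙ (image-↦ a) (image-DXvar Y x w↦)))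
                     (image-evalM m v↦))
            (image-⊙ (image-⊙ (image-↦ a) (v↦ x)) (image-DXM Y m v↦ w↦))

  image-DXP : ∀ {n} (Y : Fin n) (f : Poly 𝓜.𝓢 n) {v v′ w w′} → v ↦ᵛ v′ → w ↦ᵛ w′ →
    𝓜.DXP Y f v w ↦ 𝓝.DXP Y (mapPoly image f) v′ w′
  image-DXP Y []      v↦ w↦ = image-𝟘
  image-DXP Y (m ∷ f) v↦ w↦ = image-⊕ (image-DXM Y m v↦ w↦) (image-DXP Y f v↦ w↦)

  image-DF : ∀ {n} (F : PolyT 𝓜.𝓢 n) {v v′ w w′} → v ↦ᵛ v′ → w ↦ᵛ w′ →
    𝓜.DF F v w ↦ᵛ 𝓝.DF (mapPolyT image F) v′ w′
  image-DF F v↦ w↦ X = image-⨁ (λ Y → image-DXP Y (F X) v↦ w↦)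

  module _ {n} {H : 𝓜.Val n → 𝓜.Val n} {H′ : 𝓝.Val n → 𝓝.Val n}
           (H↦ : ∀ {w w′} → w ↦ᵛ w′ → H w ↦ᵛ H′ w′) where

    image-iter : ∀ {w w′} → w ↦ᵛ w′ → ∀ j → 𝓜.iter H j w ↦ᵛ 𝓝.iter H′ j w′
    image-iter w↦ zero    = w↦
    image-iter w↦ (suc j) = H↦ (image-iter w↦ j)

    image-star : ∀ {w w′} → w ↦ᵛ w′ → 𝓜.star H w ↦ᵛ 𝓝.star H′ w′
    image-star w↦ X z = mk⇔
      (λ { (u , (j , Hʲu) , hu) → j , to (image-iter w↦ j X z) (u , Hʲu , hu) })
      (λ { (j , Hʲz) → let (u , Hʲu , hu) = from (image-iter w↦ j X z) Hʲz
                       in u , (j , Hʲu) , hu })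

  image-newton : ∀ {n} (F : PolyT 𝓜.𝓢 n) i → 𝓜.newton F i ↦ᵛ 𝓝.newton (mapPolyT image F) i
  image-newton F zero    = image-applyT F (λ _ → image-𝟘)
  image-newton F (suc i) =
    image-star (image-DF F (image-newton F i)) (image-applyT F (image-newton F i))

lemma5 : ∀ {p n} (F : PolyT (Lang p) n) (i : ℕ) (X : Fin n) (z : Vecℕ p) →
    ΠL (𝓛.newton p F i X) z ⇔ 𝓟.newton p (ΠPolyT F) i X z
lemma5 F i X z = image-newton F i X z
  where open Image _++_ [] _+ᵥ_ 𝟎 Π Π-++
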